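{- Let $n\ge1$. Replacing each word $\underline{a}$ of the list $G_n$ by the standard permutation $\pi(\underline{a})$ yields a list in which every standard permutation of $\{\pm1,\ldots,\pm n\}$ appears exactly once and any two consecutive permutations differ by an adjacent transposition; i.e. it is an adjacent transposition Gray code for the standard permutations of $\{\pm1,\ldots,\pm n\}$.
   Context: A standard permutation of $\{\pm1,\ldots,\pm n\}$ is a word in which each element of $\{\pm1,\ldots,\pm n\}$ appears exactly once, such that for every $i$, $i$ occurs before $-i$, and the negative entries occur in the order $-1,\ldots,-n$. For a word $a_1\cdots a_n$ with $1\le a_i\le 2i-1$, $\pi(a_1\cdots a_n)$ is defined recursively: $\pi(a_1)=(1,-1)$, and for $n\ge2$, $\pi(a_1\cdots a_n)$ is obtained from $\pi(a_1\cdots a_{n-1})$ (length $2n-2$) by inserting the letter $n$ so that it occupies position $a_n$ and then appending $-n$ at the end. The list $G_n$ of words is defined recursively: $G_1=(1)$; for $n\ge2$, if $G_{n-1}=(w_1,\ldots,w_N)$, then $G_n$ is the concatenation over $m=1,\ldots,N$ of the blocks $(w_m1,w_m2,\ldots,w_m(2n-1))$ for $m$ odd and $(w_m(2n-1),\ldots,w_m2,w_m1)$ for $m$ even, where $w_mx$ denotes $w_m$ with the letter $x$ appended. Two words of length $2n$ differ by an adjacent transposition if one is obtained from the other by exchanging the entries in positions $i$ and $i+1$ for some $i$, all other entries unchanged. -}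

module Defs where

open import Data.Nat using (ℕ; zero; suc; _+_; _*_; _∸_; _<_)
open import Data.Integer as ℤ using (ℤ; +_; -_; 0ℤ)
open import Data.List using (List; []; _∷_; _++_; [_]; map; upTo; reverse; length; filter; concat)
open import Data.List.Relation.Binary.Permutation.Propositional using (_↭_)
open import Data.List.Relation.Unary.All using (All)
open import Data.List.Relation.Unary.Unique.Propositional using (Unique)
open import Data.List.Relation.Unary.Linked using (Linked)
open import Data.List.Membership.Propositional using (_∈_)
open import Data.Bool using (Bool; true; false; not)
open import Data.Product using (Σ; ∃; _×_; _,_)
open import Relation.Binary.PropositionalEquality using (_≡_)

oneTo : ℕ → List ℕ
oneTo n = map suc (upTo n)

Before : ℤ → ℤ → List ℤ → Set
Before x y l = ∃ λ l₁ → ∃ λ l₂ → ∃ λ l₃ → l ≡ l₁ ++ (x ∷ l₂ ++ (y ∷ l₃))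

signedLetters : ℕ → List ℤ
signedLetters n = map +_ (oneTo n) ++ map (λ i → - (+ i)) (oneTo n)

record StandardPerm (n : ℕ) (p : List ℤ) : Set where
  field
    isPerm    : p ↭ signedLetters n
    posBefore : ∀ i → 1 Data.Nat.≤ i → i Data.Nat.≤ n → Before (+ i) (- (+ i)) p
    negOrder  : filter (λ z → z ℤ.<? 0ℤ) p ≡ map (λ i → - (+ i)) (oneTo n)

-- insertAt k x l : insert x so that it becomes the entry at (0-based) index k
insertAt : {A : Set} → ℕ → A → List A → List A
insertAt zero    x l       = x ∷ l
insertAt (suc k) x []      = x ∷ []
insertAt (suc k) x (y ∷ l) = y ∷ insertAt k x l

-- π on the reversed word (a_n ∷ ... ∷ a_1 ∷ []); π of the empty word is ()
πrev : List ℕ → List ℤ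
πrev []       = []
πrev (a ∷ as) =
  insertAt (a ∸ 1) (+ suc (length as)) (πrev as) ++ [ - (+ suc (length as)) ]

-- π(a_1 ... a_n): letter m is inserted so as to occupy (1-based) position a_m
π : List ℕ → List ℤ
π w = πrev (reverse w)

-- blocks b k (w_1, ..., w_N) : concatenation of (w_m 1, ..., w_m k) for m odd
-- and (w_m k, ..., w_m 1) for m even; the Bool records whether m is odd
blocks : Bool → ℕ → List (List ℕ) → List (List ℕ)
blocks _     k []       = []
blocks true  k (w ∷ ws) = map (λ x → w ++ [ x ]) (oneTo k) ++ blocks false k ws
blocks false k (w ∷ ws) = map (λ x → w ++ [ x ]) (reverse (oneTo k)) ++ blocks true k ws

G : ℕ → List (List ℕ)
G zero                = []            -- unused (n ≥ 1)
G (suc zero)          = [ [ 1 ] ]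
G (suc (suc n))       = blocks true (2 * suc (suc n) ∸ 1) (G (suc n))

swapAt : {A : Set} → ℕ → List A → List A
swapAt zero    (x ∷ y ∷ l) = y ∷ x ∷ l
swapAt (suc i) (x ∷ l)     = x ∷ swapAt i l
swapAt _       l           = l

AdjTransp : List ℤ → List ℤ → Set
AdjTransp u v = ∃ λ i → suc i < length u × v ≡ swapAt i u

IsAdjGrayCode : ℕ → List (List ℤ) → Set
IsAdjGrayCode n L =
  All (StandardPerm n) L ×
  Unique L ×
  (∀ p → StandardPerm n p → p ∈ L) ×
  Linked AdjTransp L

module Submission where

-- The proof is by induction on n, through a single "insertion step".
-- Write  extend m q k  for the permutation obtained from a standard
-- permutation q of {±1,…,±m} by inserting m+1 at (0-based) index k and
-- appending −(m+1).  Then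
--   * extend m q k is standard, and (q , k) ↦ extend m q k is injective
--     for k ≤ 2m;
--   * every standard permutation of {±1,…,±(m+1)} arises this way, since
--     its last entry is necessarily −(m+1);
--   * extend m q k and extend m q (k+1) differ by an adjacent
--     transposition, as do extend m q k and extend m q' k when q and q' do,
--     provided k is an end index (0 or 2m).
-- A "boustrophedon" list sweeps k upwards for the first q, downwards for the
-- second, and so on; its generic membership, uniqueness and linkedness
-- properties turn the four facts above into: a Gray code for m yields a
-- Gray code for m+1.  Finally, π turns the recursive definition of G_{m+1}
-- into exactly this boustrophedon of the list π(G_m), which closes the
-- induction (starting from G_0 = (ε)).

open import Defs
open import Data.Nat using (ℕ; zero; suc; _+_; _*_; _<_; _≤_; z≤n; s≤s)
import Data.Nat.Properties as ℕP
open import Data.Integer as ℤ using (ℤ; +_; -_; -[1+_]; 0ℤ)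
import Data.Integer.Properties as ℤP
open import Data.Bool using (Bool; true; false; not)
open import Data.List as List
  using (List; []; _∷_; _∷ʳ′_; _++_; [_]; map; upTo; reverse; length; filter; applyUpTo; applyDownFrom)
import Data.List.Properties as ListP
open import Data.List.Membership.Propositional using (_∈_; _∉_)
open import Data.List.Membership.Propositional.Properties
open import Data.List.Relation.Unary.Any using (here; there)
open import Data.List.Relation.Unary.All as All using (All; []; _∷_)
import Data.List.Relation.Unary.All.Properties as AllP
open import Data.List.Relation.Unary.Unique.Propositional using (Unique)
open import Data.List.Relation.Unary.AllPairs using ([]; _∷_)
import Data.List.Relation.Unary.Unique.Propositional.Properties as UniqueP
open import Data.List.Relation.Unary.Linked using (Linked; []; [-]; _∷_)
open import Data.List.Relation.Binary.Disjoint.Propositional using (Disjoint)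
open import Data.List.Relation.Binary.Permutation.Propositional
import Data.List.Relation.Binary.Permutation.Propositional.Properties as PermP
import Data.List.Relation.Binary.Permutation.Setoid.Properties as SetoidPermP
open import Data.Product using (∃; _×_; _,_; proj₁; proj₂)
open import Data.Sum using (_⊎_; inj₁; inj₂)
open import Data.Empty using (⊥-elim)
open import Function using (_∘_)
open import Relation.Nullary using (¬_; Dec; does)
open import Relation.Unary using (Decidable)
open import Relation.Binary using (Symmetric)
open import Relation.Binary.PropositionalEquality as ≡
  using (_≡_; _≢_; refl; cong; cong₂; sym; subst; subst₂; module ≡-Reasoning)

open StandardPerm

module _ {A : Set} where

  insertAt-length : ∀ k (x : A) l → length (insertAt k x l) ≡ suc (length l)
  insertAt-length zero    x l       = refl
  insertAt-length (suc k) x []      = refl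
  insertAt-length (suc k) x (y ∷ l) = cong suc (insertAt-length k x l)

  insertAt-↭ : ∀ k (x : A) l → insertAt k x l ↭ x ∷ l
  insertAt-↭ zero    x l       = refl
  insertAt-↭ (suc k) x []      = refl
  insertAt-↭ (suc k) x (y ∷ l) = trans (prep y (insertAt-↭ k x l)) (swap y x refl)

  ∈-insertAt : ∀ k (x : A) l → x ∈ insertAt k x l
  ∈-insertAt zero    x l       = here refl
  ∈-insertAt (suc k) x []      = here refl
  ∈-insertAt (suc k) x (y ∷ l) = there (∈-insertAt k x l)

  ∈-insertAt⁺ : ∀ k (x : A) {z l} → z ∈ l → z ∈ insertAt k x l
  ∈-insertAt⁺ zero    x z∈l                       = there z∈l
  ∈-insertAt⁺ (suc k) x {l = _ ∷ _} (here z≡y)    = here z≡y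
  ∈-insertAt⁺ (suc k) x {l = _ ∷ _} (there z∈l)   = there (∈-insertAt⁺ k x z∈l)

  insertAt-++ : ∀ (x : A) a b → insertAt (length a) x (a ++ b) ≡ a ++ x ∷ b
  insertAt-++ x []      b = refl
  insertAt-++ x (y ∷ a) b = cong (y ∷_) (insertAt-++ x a b)

  insertAt-end : ∀ (x : A) l → insertAt (length l) x l ≡ l ++ [ x ]
  insertAt-end x []      = refl
  insertAt-end x (y ∷ l) = cong (y ∷_) (insertAt-end x l)

  insertAt-injective : ∀ {x : A} k k' l l' → x ∉ l → x ∉ l' →
                       k ≤ length l → k' ≤ length l' →
                       insertAt k x l ≡ insertAt k' x l' → l ≡ l' × k ≡ k'
  insertAt-injective zero zero l l' _ _ _ _ eq = ListP.∷-injectiveʳ eq , refl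
  insertAt-injective zero (suc k') l (y ∷ l') _ x∉l' _ _ eq
    with refl , _ ← ListP.∷-injective eq = ⊥-elim (x∉l' (here refl))
  insertAt-injective (suc k) zero (y ∷ l) l' x∉l _ _ _ eq
    with refl , _ ← ListP.∷-injective eq = ⊥-elim (x∉l (here refl))
  insertAt-injective (suc k) (suc k') (y ∷ l) (y' ∷ l') x∉l x∉l' (s≤s k≤) (s≤s k'≤) eq
    with refl , eq' ← ListP.∷-injective eq
    with refl , refl ← insertAt-injective k k' l l' (x∉l ∘ there) (x∉l' ∘ there) k≤ k'≤ eq'
    = refl , refl

  swapAt-insertAt : ∀ k (x : A) l → suc k ≤ length l →
                    swapAt k (insertAt k x l) ≡ insertAt (suc k) x l
  swapAt-insertAt zero    x (y ∷ l) _       = refl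
  swapAt-insertAt (suc k) x (y ∷ l) (s≤s h) = cong (y ∷_) (swapAt-insertAt k x l h)

  swapAt-involutive : ∀ i (l : List A) → swapAt i (swapAt i l) ≡ l
  swapAt-involutive zero    []          = refl
  swapAt-involutive zero    (x ∷ [])    = refl
  swapAt-involutive zero    (x ∷ y ∷ l) = refl
  swapAt-involutive (suc i) []          = refl
  swapAt-involutive (suc i) (x ∷ l)     = cong (x ∷_) (swapAt-involutive i l)

  swapAt-length : ∀ i (l : List A) → length (swapAt i l) ≡ length l
  swapAt-length zero    []          = refl
  swapAt-length zero    (x ∷ [])    = refl
  swapAt-length zero    (x ∷ y ∷ l) = refl
  swapAt-length (suc i) []          = refl
  swapAt-length (suc i) (x ∷ l)     = cong suc (swapAt-length i l)

  swapAt-++ : ∀ i (l r : List A) → suc i < length l → swapAt i (l ++ r) ≡ swapAt i l ++ r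
  swapAt-++ zero    (x ∷ y ∷ l) r _       = refl
  swapAt-++ zero    (x ∷ [])    r (s≤s ())
  swapAt-++ (suc i) (x ∷ l)     r (s≤s h) = cong (x ∷_) (swapAt-++ i l r h)

  filter-insertAt : ∀ {P : A → Set} (P? : Decidable P) {x} → ¬ P x →
                    ∀ k l → filter P? (insertAt k x l) ≡ filter P? l
  filter-insertAt P? ¬Px zero    l       = ListP.filter-reject P? ¬Px
  filter-insertAt P? ¬Px (suc k) []      = ListP.filter-reject P? ¬Px
  filter-insertAt P? ¬Px (suc k) (y ∷ l) with does (P? y)
  ... | true  = cong (y ∷_) (filter-insertAt P? ¬Px k l)
  ... | false = filter-insertAt P? ¬Px k l

AdjTransp-sym : Symmetric AdjTransp
AdjTransp-sym {u} (i , i+1<len , refl) =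
  i , subst (suc i <_) (sym (swapAt-length i u)) i+1<len , sym (swapAt-involutive i u)

AdjTransp-++ʳ : ∀ {u v} r → AdjTransp u v → AdjTransp (u ++ r) (v ++ r)
AdjTransp-++ʳ {u} r (i , i+1<len , refl) =
  i , ℕP.≤-trans i+1<len (ListP.length-++-≤ˡ u) , sym (swapAt-++ i u r i+1<len)

AdjTransp-∷ : ∀ {u v} w → AdjTransp u v → AdjTransp (w ∷ u) (w ∷ v)
AdjTransp-∷ w (i , i+1<len , eq) = suc i , s≤s i+1<len , cong (w ∷_) eq

-- sweep true f K = f 0, …, f (K−1)   and   sweep false f K = f (K−1), …, f 0.
-- boustrophedon b K f (a₁, a₂, …) sweeps f a₁ in direction b, f a₂ in the
-- opposite direction, and so on; both G_{m+1} and the list of extensions of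
-- a Gray code have this shape.

sweep : {B : Set} → Bool → (ℕ → B) → ℕ → List B
sweep true  f K = applyUpTo f K
sweep false f K = applyDownFrom f K

-- the index at which a sweep of length N+1 in direction b ends
sweepEnd : Bool → ℕ → ℕ
sweepEnd true  N = N
sweepEnd false N = 0

boustrophedon : {A B : Set} → Bool → ℕ → (A → ℕ → B) → List A → List B
boustrophedon b K f []       = []
boustrophedon b K f (a ∷ as) = sweep b (f a) K ++ boustrophedon (not b) K f as

module _ {B : Set} where

  sweep-cong : ∀ b {f g : ℕ → B} → (∀ j → f j ≡ g j) → ∀ K → sweep b f K ≡ sweep b g K
  sweep-cong true  f≗g zero    = refl
  sweep-cong false f≗g zero    = refl
  sweep-cong true  f≗g (suc K) = cong₂ _∷_ (f≗g 0) (sweep-cong true (f≗g ∘ suc) K)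
  sweep-cong false f≗g (suc K) = cong₂ _∷_ (f≗g K) (sweep-cong false f≗g K)

  map-sweep : ∀ {C : Set} (g : B → C) b (f : ℕ → B) K → map g (sweep b f K) ≡ sweep b (λ j → g (f j)) K
  map-sweep g true  f K = ListP.map-applyUpTo f g K
  map-sweep g false f K = ListP.map-applyDownFrom f g K

  ∈-sweep⁻ : ∀ b (f : ℕ → B) K {v} → v ∈ sweep b f K → ∃ λ j → j < K × v ≡ f j
  ∈-sweep⁻ true  f K = ∈-applyUpTo⁻ f
  ∈-sweep⁻ false f K = ∈-applyDownFrom⁻ f

  ∈-sweep⁺ : ∀ b (f : ℕ → B) {K j} → j < K → f j ∈ sweep b f K
  ∈-sweep⁺ true  f = ∈-applyUpTo⁺ f
  ∈-sweep⁺ false f = ∈-applyDownFrom⁺ f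

  all-sweep : ∀ {P : B → Set} b (f : ℕ → B) K → (∀ j → P (f j)) → All P (sweep b f K)
  all-sweep true  f K Pf = AllP.applyUpTo⁺₂ f K Pf
  all-sweep false f K Pf = AllP.applyDownFrom⁺₂ f K Pf

  unique-sweep : ∀ b (f : ℕ → B) K → (∀ {i j} → i < K → j < K → f i ≡ f j → i ≡ j) → Unique (sweep b f K)
  unique-sweep true  f K inj =
    UniqueP.applyUpTo⁺₁ f K (λ i<j j<K eq → ℕP.<⇒≢ i<j (inj (ℕP.<-trans i<j j<K) j<K eq))
  unique-sweep false f K inj =
    UniqueP.applyDownFrom⁺₁ f K (λ j<i i<K eq → ℕP.<⇒≢ j<i (sym (inj i<K (ℕP.<-trans j<i i<K) eq)))

  linked-sweep : ∀ {R : B → B → Set} → Symmetric R → ∀ b (f : ℕ → B) N {rest} →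
                 (∀ j → j < N → R (f j) (f (suc j))) →
                 Linked R (f (sweepEnd b N) ∷ rest) → Linked R (sweep b f (suc N) ++ rest)
  linked-sweep sym-R true  f zero    step end = end
  linked-sweep sym-R true  f (suc N) step end =
    step 0 (s≤s z≤n) ∷ linked-sweep sym-R true (λ j → f (suc j)) N (λ j j<N → step (suc j) (s≤s j<N)) end
  linked-sweep sym-R false f zero    step end = end
  linked-sweep sym-R false f (suc N) step end =
    sym-R (step N ℕP.≤-refl) ∷ linked-sweep sym-R false f N (λ j j<N → step j (ℕP.m≤n⇒m≤1+n j<N)) end

module _ {A B : Set} where

  map-boustrophedon : ∀ {C : Set} (g : B → C) b K (f : A → ℕ → B) as →
                      map g (boustrophedon b K f as) ≡ boustrophedon b K (λ a j → g (f a j)) as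
  map-boustrophedon g b K f []       = refl
  map-boustrophedon g b K f (a ∷ as) = begin
    map g (sweep b (f a) K ++ boustrophedon (not b) K f as)
      ≡⟨ ListP.map-++ g (sweep b (f a) K) _ ⟩
    map g (sweep b (f a) K) ++ map g (boustrophedon (not b) K f as)
      ≡⟨ cong₂ _++_ (map-sweep g b (f a) K) (map-boustrophedon g (not b) K f as) ⟩
    sweep b (λ j → g (f a j)) K ++ boustrophedon (not b) K (λ a j → g (f a j)) as ∎
    where open ≡-Reasoning

  boustrophedon-map : ∀ {C : Set} b K (f : A → ℕ → B) (h : C → A) cs →
                      boustrophedon b K f (map h cs) ≡ boustrophedon b K (λ c → f (h c)) cs
  boustrophedon-map b K f h []       = refl
  boustrophedon-map b K f h (c ∷ cs) = cong (sweep b (f (h c)) K ++_) (boustrophedon-map (not b) K f h cs)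

  boustrophedon-cong : ∀ {P : A → Set} b K {f g : A → ℕ → B} →
                       (∀ {a} → P a → ∀ j → f a j ≡ g a j) →
                       ∀ {as} → All P as → boustrophedon b K f as ≡ boustrophedon b K g as
  boustrophedon-cong b K f≗g []         = refl
  boustrophedon-cong b K f≗g (pa ∷ pas) =
    cong₂ _++_ (sweep-cong b (f≗g pa) K) (boustrophedon-cong (not b) K f≗g pas)

  ∈-boustrophedon⁻ : ∀ b K (f : A → ℕ → B) as {v} → v ∈ boustrophedon b K f as →
                     ∃ λ a → a ∈ as × ∃ λ j → j < K × v ≡ f a j
  ∈-boustrophedon⁻ b K f (a ∷ as) v∈ with ∈-++⁻ (sweep b (f a) K) v∈
  ... | inj₁ v∈sweep = a , here refl , ∈-sweep⁻ b (f a) K v∈sweep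
  ... | inj₂ v∈rest  =
    let a' , a'∈ , rest = ∈-boustrophedon⁻ (not b) K f as v∈rest in a' , there a'∈ , rest

  ∈-boustrophedon⁺ : ∀ b K (f : A → ℕ → B) {as a j} → a ∈ as → j < K → f a j ∈ boustrophedon b K f as
  ∈-boustrophedon⁺ b K f {a ∷ as} (here refl) j<K = ∈-++⁺ˡ (∈-sweep⁺ b (f a) j<K)
  ∈-boustrophedon⁺ b K f {a ∷ as} (there a∈) j<K =
    ∈-++⁺ʳ (sweep b (f a) K) (∈-boustrophedon⁺ (not b) K f a∈ j<K)

  all-boustrophedon : ∀ {P : A → Set} {Q : B → Set} b K (f : A → ℕ → B) →
                      (∀ {a} → P a → ∀ j → Q (f a j)) →
                      ∀ {as} → All P as → All Q (boustrophedon b K f as)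
  all-boustrophedon b K f PQ []         = []
  all-boustrophedon b K f PQ (pa ∷ pas) =
    AllP.++⁺ (all-sweep b (f _) K (PQ pa)) (all-boustrophedon (not b) K f PQ pas)

  unique-boustrophedon :
    ∀ {P : A → Set} b K (f : A → ℕ → B) →
    (∀ {a a' j j'} → P a → P a' → j < K → j' < K → f a j ≡ f a' j' → a ≡ a' × j ≡ j') →
    ∀ {as} → All P as → Unique as → Unique (boustrophedon b K f as)
  unique-boustrophedon b K f inj {[]}     _          _              = []
  unique-boustrophedon b K f inj {a ∷ as} (pa ∷ pas) (a∉as ∷ uniq) =
    UniqueP.++⁺ (unique-sweep b (f a) K (λ i<K j<K eq → proj₂ (inj pa pa i<K j<K eq)))
                (unique-boustrophedon (not b) K f inj pas uniq)
                disjoint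
    where
    disjoint : Disjoint (sweep b (f a) K) (boustrophedon (not b) K f as)
    disjoint (v∈sweep , v∈rest) =
      let j , j<K , v≡faj = ∈-sweep⁻ b (f a) K v∈sweep
          a' , a'∈as , j' , j'<K , v≡fa'j' = ∈-boustrophedon⁻ (not b) K f as v∈rest
      in All.lookup a∉as a'∈as
           (proj₁ (inj pa (All.lookup pas a'∈as) j<K j'<K (≡.trans (sym v≡faj) v≡fa'j')))

  linked-boustrophedon :
    ∀ {P : A → Set} {R : B → B → Set} {S : A → A → Set} → Symmetric R → ∀ b N (f : A → ℕ → B) →
    (∀ {a} → P a → ∀ j → j < N → R (f a j) (f a (suc j))) →
    (∀ {a a'} c → P a → P a' → S a a' → R (f a (sweepEnd c N)) (f a' (sweepEnd c N))) →
    ∀ {as} → All P as → Linked S as → Linked R (boustrophedon b (suc N) f as)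
  linked-boustrophedon sym-R b N f inner turn [] _ = []
  linked-boustrophedon sym-R b N f inner turn (pa ∷ []) _ =
    linked-sweep sym-R b (f _) N (inner pa) [-]
  linked-boustrophedon sym-R true N f inner turn (pa ∷ pa' ∷ pas) (s ∷ ss) =
    linked-sweep sym-R true (f _) N (inner pa)
      (turn true pa pa' s ∷ linked-boustrophedon sym-R false N f inner turn (pa' ∷ pas) ss)
  linked-boustrophedon sym-R false N f inner turn (pa ∷ pa' ∷ pas) (s ∷ ss) =
    linked-sweep sym-R false (f _) N (inner pa)
      (turn false pa pa' s ∷ linked-boustrophedon sym-R true N f inner turn (pa' ∷ pas) ss)

data Precedes (u v : ℤ) : List ℤ → Set where
  now   : ∀ {l} → v ∈ l → Precedes u v (u ∷ l)
  later : ∀ {w l} → Precedes u v l → Precedes u v (w ∷ l)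

Before→Precedes : ∀ {u v l} → Before u v l → Precedes u v l
Before→Precedes (l₁ , l₂ , l₃ , refl) = go l₁
  where
  go : ∀ {u v l₂ l₃} l₁ → Precedes u v (l₁ ++ u ∷ l₂ ++ v ∷ l₃)
  go {l₂ = l₂} []       = now (∈-++⁺ʳ l₂ (here refl))
  go           (w ∷ l₁) = later (go l₁)

Precedes→Before : ∀ {u v l} → Precedes u v l → Before u v l
Precedes→Before (now v∈l) with ys , zs , refl ← ∈-∃++ v∈l = [] , ys , zs , refl
Precedes→Before {l = w ∷ _} (later p) with l₁ , l₂ , l₃ , refl ← Precedes→Before p =
  w ∷ l₁ , l₂ , l₃ , refl

precedes-insertAt : ∀ {u v l} k x → Precedes u v l → Precedes u v (insertAt k x l)
precedes-insertAt zero    x p         = later p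
precedes-insertAt (suc k) x (now v∈l) = now (∈-insertAt⁺ k x v∈l)
precedes-insertAt (suc k) x (later p) = later (precedes-insertAt k x p)

precedes-++ʳ : ∀ {u v l} r → Precedes u v l → Precedes u v (l ++ r)
precedes-++ʳ r (now v∈l) = now (∈-++⁺ˡ v∈l)
precedes-++ʳ r (later p) = later (precedes-++ʳ r p)

precedes-last : ∀ {u v} l → u ∈ l → Precedes u v (l ++ [ v ])
precedes-last (_ ∷ l) (here refl) = now (∈-++⁺ʳ l (here refl))
precedes-last (_ ∷ l) (there u∈l) = later (precedes-last l u∈l)

precedes-delete : ∀ {u v x} a b → u ≢ x → v ≢ x → Precedes u v (a ++ x ∷ b) → Precedes u v (a ++ b)
precedes-delete []      b u≢x v≢x (now _)   = ⊥-elim (u≢x refl)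
precedes-delete []      b u≢x v≢x (later p) = p
precedes-delete (w ∷ a) b u≢x v≢x (now v∈) with ∈-++⁻ a v∈
... | inj₁ v∈a          = now (∈-++⁺ˡ v∈a)
... | inj₂ (here v≡x)   = ⊥-elim (v≢x v≡x)
... | inj₂ (there v∈b)  = now (∈-++⁺ʳ a v∈b)
precedes-delete (w ∷ a) b u≢x v≢x (later p) = later (precedes-delete a b u≢x v≢x p)

precedes-unsnoc : ∀ {u v y} l → v ≢ y → Precedes u v (l ++ [ y ]) → Precedes u v l
precedes-unsnoc []      v≢y (now ())
precedes-unsnoc []      v≢y (later ())
precedes-unsnoc (w ∷ l) v≢y (now v∈) with ∈-++⁻ l v∈
... | inj₁ v∈l        = now v∈l
... | inj₂ (here v≡y) = ⊥-elim (v≢y v≡y)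
precedes-unsnoc (w ∷ l) v≢y (later p) = later (precedes-unsnoc l v≢y p)

last-precedes-nothing : ∀ {u v} l → Unique (l ++ [ u ]) → ¬ Precedes u v (l ++ [ u ])
last-precedes-nothing []      _           (later ())
last-precedes-nothing (w ∷ l) (w∉ ∷ _)    (now _)   = All.lookup w∉ (∈-++⁺ʳ l (here refl)) refl
last-precedes-nothing (w ∷ l) (_ ∷ uniq)  (later p) = last-precedes-nothing l uniq p

positives negatives : ℕ → List ℤ
positives n = map +_ (oneTo n)
negatives n = map (λ i → - (+ i)) (oneTo n)

∈-oneTo⁻ : ∀ {m j} → j ∈ oneTo m → ∃ λ i → i < m × j ≡ suc i
∈-oneTo⁻ j∈ with i , i∈ , refl ← ∈-map⁻ suc j∈ = i , ∈-upTo⁻ i∈ , refl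

oneTo-suc : ∀ m → oneTo (suc m) ≡ oneTo m ++ [ suc m ]
oneTo-suc m = ≡.trans (cong (map suc) (sym (ListP.upTo-∷ʳ m))) (ListP.map-++ suc (upTo m) [ m ])

∈-positives⁻ : ∀ {m z} → z ∈ positives m → ∃ λ i → i < m × z ≡ + suc i
∈-positives⁻ z∈ with j , j∈ , refl ← ∈-map⁻ +_ z∈
                with i , i<m , refl ← ∈-oneTo⁻ j∈ = i , i<m , refl

∈-negatives⁻ : ∀ {m z} → z ∈ negatives m → ∃ λ i → i < m × z ≡ -[1+ i ]
∈-negatives⁻ z∈ with j , j∈ , refl ← ∈-map⁻ (λ i → - (+ i)) z∈
                with i , i<m , refl ← ∈-oneTo⁻ j∈ = i , i<m , refl

∈-signedLetters⁻ : ∀ {m z} → z ∈ signedLetters m →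
                   (∃ λ i → i < m × z ≡ + suc i) ⊎ (∃ λ i → i < m × z ≡ -[1+ i ])
∈-signedLetters⁻ {m} z∈ with ∈-++⁻ (positives m) z∈
... | inj₁ z∈pos = inj₁ (∈-positives⁻ z∈pos)
... | inj₂ z∈neg = inj₂ (∈-negatives⁻ z∈neg)

unique-signedLetters : ∀ m → Unique (signedLetters m)
unique-signedLetters m =
  UniqueP.++⁺ (UniqueP.map⁺ ℤP.+-injective unique-oneTo)
              (UniqueP.map⁺ (ℤP.+-injective ∘ ℤP.neg-injective) unique-oneTo)
              disjoint
  where
  unique-oneTo : Unique (oneTo m)
  unique-oneTo = UniqueP.map⁺ ℕP.suc-injective (UniqueP.upTo⁺ m)
  disjoint : Disjoint (positives m) (negatives m)
  disjoint (z∈pos , z∈neg) with ∈-positives⁻ z∈pos | ∈-negatives⁻ z∈neg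
  ... | _ , _ , refl | _ , _ , ()

length-signedLetters : ∀ m → length (signedLetters m) ≡ 2 * m
length-signedLetters m = begin
  length (positives m ++ negatives m)      ≡⟨ ListP.length-++ (positives m) ⟩
  length (positives m) + length (negatives m)
    ≡⟨ cong₂ _+_ (≡.trans (ListP.length-map +_ (oneTo m)) length-oneTo)
                 (≡.trans (ListP.length-map _ (oneTo m)) length-oneTo) ⟩
  m + m                                    ≡⟨ cong (λ k → m + k) (sym (ℕP.+-identityʳ m)) ⟩
  2 * m                                    ∎
  where
  open ≡-Reasoning
  length-oneTo : length (oneTo m) ≡ m
  length-oneTo = ≡.trans (ListP.length-map suc (upTo m)) (ListP.length-upTo m)

signedLetters-suc : ∀ m → signedLetters (suc m) ↭ + suc m ∷ -[1+ m ] ∷ signedLetters m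
signedLetters-suc m = begin
  signedLetters (suc m)              ≡⟨ split ⟩
  P ++ [ x ] ++ (N ++ [ y ])         ↭⟨ PermP.shift x P (N ++ [ y ]) ⟩
  x ∷ P ++ N ++ [ y ]                ≡⟨ cong (x ∷_) (sym (ListP.++-assoc P N [ y ])) ⟩
  x ∷ (P ++ N) ++ [ y ]              ↭⟨ prep x (PermP.++-comm (P ++ N) [ y ]) ⟩
  x ∷ y ∷ signedLetters m            ∎
  where
  open PermutationReasoning
  x = + suc m
  y = -[1+ m ]
  P = positives m
  N = negatives m
  split : signedLetters (suc m) ≡ P ++ [ x ] ++ (N ++ [ y ])
  split = ≡.trans (cong (λ l → map +_ l ++ map (λ i → - (+ i)) l) (oneTo-suc m))
            (≡.trans (cong₂ _++_ (ListP.map-++ +_ (oneTo m) [ suc m ])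
                                 (ListP.map-++ (λ i → - (+ i)) (oneTo m) [ suc m ]))
                     (ListP.++-assoc P [ x ] (N ++ [ y ])))

+suc∈signedLetters : ∀ m → + suc m ∈ signedLetters (suc m)
+suc∈signedLetters m = PermP.∈-resp-↭ (↭-sym (signedLetters-suc m)) (here refl)

+suc∉signedLetters : ∀ m → + suc m ∉ signedLetters m
+suc∉signedLetters m z∈ with ∈-signedLetters⁻ z∈
... | inj₁ (i , i<m , eq) = ℕP.<-irrefl (sym (ℕP.suc-injective (ℤP.+-injective eq))) i<m
... | inj₂ (_ , _ , ())

negative? : (z : ℤ) → Dec (z ℤ.< 0ℤ)
negative? z = z ℤ.<? 0ℤ

negativeEntries : List ℤ → List ℤ
negativeEntries = filter negative?

¬+<0 : ∀ i → ¬ (+ i ℤ.< 0ℤ)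
¬+<0 i (ℤ.+<+ ())

negatives-suc : ∀ m → negatives (suc m) ≡ negatives m ++ [ -[1+ m ] ]
negatives-suc m = ≡.trans (cong (map (λ i → - (+ i))) (oneTo-suc m)) (ListP.map-++ _ (oneTo m) [ suc m ])

module _ {m q} (S : StandardPerm m q) where

  length-standard : length q ≡ 2 * m
  length-standard = ≡.trans (PermP.↭-length (isPerm S)) (length-signedLetters m)

  unique-standard : Unique q
  unique-standard = SetoidPermP.Unique-resp-↭ (≡.setoid ℤ) (↭⇒↭ₛ (↭-sym (isPerm S))) (unique-signedLetters m)

  +suc∉standard : + suc m ∉ q
  +suc∉standard = +suc∉signedLetters m ∘ PermP.∈-resp-↭ (isPerm S)

extend : ℕ → List ℤ → ℕ → List ℤ
extend m q k = insertAt k (+ suc m) q ++ [ -[1+ m ] ]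

extend-standard : ∀ {m q} → StandardPerm m q → ∀ k → StandardPerm (suc m) (extend m q k)
extend-standard {m} {q} S k = record
  { isPerm    = perm
  ; posBefore = λ i 1≤i i≤1+m → Precedes→Before (precedes i 1≤i i≤1+m)
  ; negOrder  = begin
      negativeEntries (insertAt k x q ++ [ y ])
        ≡⟨ ListP.filter-++ negative? (insertAt k x q) [ y ] ⟩
      negativeEntries (insertAt k x q) ++ [ y ]
        ≡⟨ cong (_++ [ y ]) (filter-insertAt negative? (¬+<0 (suc m)) k q) ⟩
      negativeEntries q ++ [ y ]
        ≡⟨ cong (_++ [ y ]) (negOrder S) ⟩
      negatives m ++ [ y ]
        ≡⟨ sym (negatives-suc m) ⟩
      negatives (suc m) ∎
  }
  where
  open ≡-Reasoning
  x = + suc m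
  y = -[1+ m ]
  perm : extend m q k ↭ signedLetters (suc m)
  perm = trans (PermP.++⁺ʳ [ y ] (insertAt-↭ k x q))
          (trans (prep x (PermP.++-comm q [ y ]))
            (trans (prep x (prep y (isPerm S))) (↭-sym (signedLetters-suc m))))
  -- i < m+1 is inherited from q; i = m+1 is inserted before −(m+1) at the end
  precedes : ∀ i → 1 ≤ i → i ≤ suc m → Precedes (+ i) (- (+ i)) (extend m q k)
  precedes i 1≤i i≤1+m with ℕP.m≤n⇒m<n∨m≡n i≤1+m
  ... | inj₁ (s≤s i≤m) =
    precedes-++ʳ [ y ] (precedes-insertAt k x (Before→Precedes (posBefore S i 1≤i i≤m)))
  ... | inj₂ refl = precedes-last (insertAt k x q) (∈-insertAt k x q)

extend-injective : ∀ {m q q' i j} → StandardPerm m q → StandardPerm m q' →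
                   i ≤ 2 * m → j ≤ 2 * m → extend m q i ≡ extend m q' j → q ≡ q' × i ≡ j
extend-injective {m} {q} {q'} {i} {j} S S' i≤ j≤ eq =
  insertAt-injective i j q q' (+suc∉standard S) (+suc∉standard S')
    (subst (i ≤_) (sym (length-standard S)) i≤) (subst (j ≤_) (sym (length-standard S')) j≤)
    (ListP.∷ʳ-injectiveˡ (insertAt i (+ suc m) q) (insertAt j (+ suc m) q') eq)

-- The last entry of a standard permutation of {±1,…,±(m+1)} is −(m+1):
-- a positive letter +i must be followed by −i, and the negative letters
-- end with −(m+1).
standard-last : ∀ {m} p z → StandardPerm (suc m) (p ++ [ z ]) → z ≡ -[1+ m ]
standard-last {m} p z S with ∈-signedLetters⁻ {suc m} (PermP.∈-resp-↭ (isPerm S) (∈-++⁺ʳ p (here refl)))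
... | inj₁ (i , i<1+m , refl) =
  ⊥-elim (last-precedes-nothing p (unique-standard S)
            (Before→Precedes (posBefore S (suc i) (s≤s z≤n) i<1+m)))
... | inj₂ (i , _ , refl) = proj₂ (ListP.∷ʳ-injective (negativeEntries p) (negatives m) negatives-end)
  where
  open ≡-Reasoning
  negatives-end : negativeEntries p ++ [ -[1+ i ] ] ≡ negatives m ++ [ -[1+ m ] ]
  negatives-end = begin
    negativeEntries p ++ [ -[1+ i ] ]       ≡⟨ sym (ListP.filter-++ negative? p [ -[1+ i ] ]) ⟩
    negativeEntries (p ++ [ -[1+ i ] ])     ≡⟨ negOrder S ⟩
    negatives (suc m)                       ≡⟨ negatives-suc m ⟩
    negatives m ++ [ -[1+ m ] ]             ∎

standard-remove : ∀ {m} a b → StandardPerm (suc m) ((a ++ + suc m ∷ b) ++ [ -[1+ m ] ]) →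
                  StandardPerm m (a ++ b)
standard-remove {m} a b S = record
  { isPerm    = PermP.drop-∷ (PermP.drop-∷ (trans (↭-sym perm) (trans (isPerm S) (signedLetters-suc m))))
  ; posBefore = λ i 1≤i i≤m → Precedes→Before (precedes i 1≤i i≤m)
  ; negOrder  = proj₁ (ListP.∷ʳ-injective (negativeEntries (a ++ b)) (negatives m) negatives-end)
  }
  where
  open ≡-Reasoning
  x = + suc m
  y = -[1+ m ]
  perm : (a ++ x ∷ b) ++ [ y ] ↭ x ∷ y ∷ a ++ b
  perm = trans (↭-reflexive (ListP.++-assoc a (x ∷ b) [ y ]))
          (trans (PermP.shift x a (b ++ [ y ]))
            (prep x (trans (↭-reflexive (sym (ListP.++-assoc a b [ y ]))) (PermP.++-comm (a ++ b) [ y ]))))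
  precedes : ∀ i → 1 ≤ i → i ≤ m → Precedes (+ i) (- (+ i)) (a ++ b)
  precedes (suc i) (s≤s z≤n) i<m =
    precedes-delete a b (λ { refl → ℕP.<-irrefl refl i<m }) (λ ())
      (precedes-unsnoc (a ++ x ∷ b) (λ { refl → ℕP.<-irrefl refl i<m })
        (Before→Precedes (posBefore S (suc i) (s≤s z≤n) (ℕP.m≤n⇒m≤1+n i<m))))
  negatives-end : negativeEntries (a ++ b) ++ [ y ] ≡ negatives m ++ [ y ]
  negatives-end = begin
    negativeEntries (a ++ b) ++ [ y ]
      ≡⟨ cong (_++ [ y ]) (ListP.filter-++ negative? a b) ⟩
    (negativeEntries a ++ negativeEntries b) ++ [ y ]
      ≡⟨ cong (λ l → (negativeEntries a ++ l) ++ [ y ]) (sym (ListP.filter-reject negative? {xs = b} (¬+<0 (suc m)))) ⟩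
    (negativeEntries a ++ negativeEntries (x ∷ b)) ++ [ y ]
      ≡⟨ cong (_++ [ y ]) (sym (ListP.filter-++ negative? a (x ∷ b))) ⟩
    negativeEntries (a ++ x ∷ b) ++ [ y ]
      ≡⟨ sym (ListP.filter-++ negative? (a ++ x ∷ b) [ y ]) ⟩
    negativeEntries ((a ++ x ∷ b) ++ [ y ])
      ≡⟨ negOrder S ⟩
    negatives (suc m)
      ≡⟨ negatives-suc m ⟩
    negatives m ++ [ y ] ∎

extend-surjective : ∀ {m p} → StandardPerm (suc m) p →
                    ∃ λ q → ∃ λ k → k ≤ 2 * m × StandardPerm m q × p ≡ extend m q k
extend-surjective {m} {p} S with +suc∈p ← PermP.∈-resp-↭ (↭-sym (isPerm S)) (+suc∈signedLetters m)
                          with List.initLast p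
... | [] with () ← +suc∈p
... | p₀ ∷ʳ′ z with refl ← standard-last p₀ z S with ∈-++⁻ p₀ +suc∈p
...   | inj₂ (here ())
...   | inj₁ +suc∈p₀ with a , b , refl ← ∈-∃++ +suc∈p₀ =
  a ++ b , length a , k≤2m , Sq , cong (_++ [ -[1+ m ] ]) (sym (insertAt-++ (+ suc m) a b))
  where
  Sq : StandardPerm m (a ++ b)
  Sq = standard-remove a b S
  k≤2m : length a ≤ 2 * m
  k≤2m = ℕP.≤-trans (ListP.length-++-≤ˡ a) (ℕP.≤-reflexive (length-standard Sq))

extend-adjacent : ∀ {m q} → StandardPerm m q → ∀ j → j < 2 * m →
                  AdjTransp (extend m q j) (extend m q (suc j))
extend-adjacent {m} {q} S j j<2m =
  j , in-range , (begin
    insertAt (suc j) x q ++ [ y ]        ≡⟨ cong (_++ [ y ]) (sym (swapAt-insertAt j x q j<len)) ⟩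
    swapAt j (insertAt j x q) ++ [ y ]   ≡⟨ sym (swapAt-++ j (insertAt j x q) [ y ] j+1<len) ⟩
    swapAt j (extend m q j)              ∎)
  where
  open ≡-Reasoning
  x = + suc m
  y = -[1+ m ]
  j<len : suc j ≤ length q
  j<len = subst (suc j ≤_) (sym (length-standard S)) j<2m
  j+1<len : suc j < length (insertAt j x q)
  j+1<len = subst (suc j <_) (sym (insertAt-length j x q)) (s≤s j<len)
  in-range : suc j < length (extend m q j)
  in-range = ℕP.≤-trans j+1<len (ListP.length-++-≤ˡ (insertAt j x q))

extend-adjacent-turn : ∀ {m q q'} c → StandardPerm m q → StandardPerm m q' → AdjTransp q q' →
                       AdjTransp (extend m q (sweepEnd c (2 * m))) (extend m q' (sweepEnd c (2 * m)))
extend-adjacent-turn {m} false S S' q~q' = AdjTransp-∷ (+ suc m) (AdjTransp-++ʳ [ -[1+ m ] ] q~q')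
extend-adjacent-turn {m} {q} {q'} true S S' q~q' =
  subst₂ AdjTransp (extend-last S) (extend-last S') (AdjTransp-++ʳ [ -[1+ m ] ] (AdjTransp-++ʳ [ + suc m ] q~q'))
  where
  extend-last : ∀ {r} → StandardPerm m r → (r ++ [ + suc m ]) ++ [ -[1+ m ] ] ≡ extend m r (2 * m)
  extend-last {r} Sr =
    cong (_++ [ -[1+ m ] ]) (sym (≡.trans (cong (λ k → insertAt k (+ suc m) r) (sym (length-standard Sr)))
                                          (insertAt-end (+ suc m) r)))

grayCode-step : ∀ {m L} → IsAdjGrayCode m L →
                IsAdjGrayCode (suc m) (boustrophedon true (suc (2 * m)) (extend m) L)
grayCode-step {m} {L} (standard , unique , complete , linked) =
  all-boustrophedon true K (extend m) extend-standard standard ,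
  unique-boustrophedon true K (extend m)
    (λ S S' j<K j'<K → extend-injective S S' (ℕP.≤-pred j<K) (ℕP.≤-pred j'<K)) standard unique ,
  complete′ ,
  linked-boustrophedon AdjTransp-sym true (2 * m) (extend m) extend-adjacent extend-adjacent-turn standard linked
  where
  K = suc (2 * m)
  complete′ : ∀ p → StandardPerm (suc m) p → p ∈ boustrophedon true K (extend m) L
  complete′ p S with q , k , k≤2m , Sq , refl ← extend-surjective S =
    ∈-boustrophedon⁺ true K (extend m) (complete q Sq) (s≤s k≤2m)

π-snoc : ∀ w j → π (w ++ [ suc j ]) ≡ extend (length w) (π w) j
π-snoc w j = ≡.trans (cong πrev (ListP.reverse-++ w [ suc j ]))
                     (cong (λ n → extend n (π w) j) (ListP.length-reverse w))

blocks-boustrophedon : ∀ b K ws → blocks b K ws ≡ boustrophedon b K (λ w j → w ++ [ suc j ]) ws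
blocks-boustrophedon b     K []       = refl
blocks-boustrophedon true  K (w ∷ ws) = cong₂ _++_ (begin
  map (λ x → w ++ [ x ]) (map suc (upTo K))   ≡⟨ cong (map _) (ListP.map-upTo suc K) ⟩
  map (λ x → w ++ [ x ]) (applyUpTo suc K)    ≡⟨ ListP.map-applyUpTo suc _ K ⟩
  applyUpTo (λ j → w ++ [ suc j ]) K          ∎) (blocks-boustrophedon false K ws)
  where open ≡-Reasoning
blocks-boustrophedon false K (w ∷ ws) = cong₂ _++_ (begin
  map (λ x → w ++ [ x ]) (reverse (map suc (upTo K)))   ≡⟨ cong (map _ ∘ reverse) (ListP.map-upTo suc K) ⟩
  map (λ x → w ++ [ x ]) (reverse (applyUpTo suc K))    ≡⟨ cong (map _) (ListP.reverse-applyUpTo suc K) ⟩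
  map (λ x → w ++ [ x ]) (applyDownFrom suc K)          ≡⟨ ListP.map-applyDownFrom suc _ K ⟩
  applyDownFrom (λ j → w ++ [ suc j ]) K                ∎) (blocks-boustrophedon true K ws)
  where open ≡-Reasoning

blocks-length : ∀ {m} b K {ws} → All (λ w → length w ≡ m) ws → All (λ w → length w ≡ suc m) (blocks b K ws)
blocks-length {m} b K {ws} lengths =
  subst (All (λ w → length w ≡ suc m)) (sym (blocks-boustrophedon b K ws))
    (all-boustrophedon b K _ (λ {w} |w|≡m j → ≡.trans (ListP.length-++ w) (≡.trans (cong (_+ 1) |w|≡m) (ℕP.+-comm m 1)))
      lengths)

π-blocks : ∀ {m} b K {ws} → All (λ w → length w ≡ m) ws →
           map π (blocks b K ws) ≡ boustrophedon b K (extend m) (map π ws)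
π-blocks {m} b K {ws} lengths = begin
  map π (blocks b K ws)
    ≡⟨ cong (map π) (blocks-boustrophedon b K ws) ⟩
  map π (boustrophedon b K (λ w j → w ++ [ suc j ]) ws)
    ≡⟨ map-boustrophedon π b K _ ws ⟩
  boustrophedon b K (λ w j → π (w ++ [ suc j ])) ws
    ≡⟨ boustrophedon-cong b K (λ {w} |w|≡m j → ≡.trans (π-snoc w j) (cong (λ n → extend n (π w) j) |w|≡m)) lengths ⟩
  boustrophedon b K (λ w j → extend m (π w) j) ws
    ≡⟨ sym (boustrophedon-map b K (extend m) π ws) ⟩
  boustrophedon b K (extend m) (map π ws) ∎
  where open ≡-Reasoning

-- G extended by G₀ = (ε), so that G_{m+1} = blocks true (2m+1) G_m for all m.
G′ : ℕ → List (List ℕ)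
G′ zero    = [ [] ]
G′ (suc m) = G (suc m)

G′-step : ∀ m → G (suc m) ≡ blocks true (suc (2 * m)) (G′ m)
G′-step zero    = refl
G′-step (suc m) = cong (λ k → blocks true (suc k) (G (suc m))) (ℕP.+-suc m (suc (m + 0)))

G′-length : ∀ m → All (λ w → length w ≡ m) (G′ m)
G′-length zero    = refl ∷ []
G′-length (suc m) = subst (All (λ w → length w ≡ suc m)) (sym (G′-step m)) (blocks-length true _ (G′-length m))

grayCode-zero : IsAdjGrayCode 0 [ [] ]
grayCode-zero =
  record { isPerm = refl ; posBefore = λ { _ (s≤s _) () } ; negOrder = refl } ∷ [] ,
  [] ∷ [] ,
  (λ p S → here (PermP.↭-empty-inv (isPerm S))) ,
  [-]

grayCode : ∀ m → IsAdjGrayCode m (map π (G′ m))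
grayCode zero    = grayCode-zero
grayCode (suc m) =
  subst (IsAdjGrayCode (suc m)) (sym (≡.trans (cong (map π) (G′-step m)) (π-blocks true _ (G′-length m))))
    (grayCode-step (grayCode m))

theorem4p1 : (n : ℕ) → 1 ≤ n → IsAdjGrayCode n (map π (G n))
theorem4p1 zero    ()
theorem4p1 (suc m) _ = grayCode (suc m)
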